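{- For any nonempty graphs $G$ and $H$ of orders $n\ge 2$ and $n'\ge 2$, respectively, $$\gamma_{\rm sp}(G\Box H)\le nn'-n-n'+4.$$ Furthermore, for any integers $n\ge 4$ and $n'\ge 4$, $$\gamma_{\rm sp}(K_n\Box K_{n'})=nn'-n-n'+4,$$ and for any integer $n\ge 3$, $$\gamma_{\rm sp}(K_n\Box K_3)=2n.$$
   Context: All graphs are finite, simple and undirected; a graph is nonempty if it has at least one edge; $K_m$ is the complete graph on $m$ vertices. For a vertex $v$, $N(v)$ is its set of neighbours; for $D\subseteq V(G)$, $\overline{D}=V(G)\setminus D$. A set $D\subseteq V(G)$ is a super dominating set of $G$ if for every $u\in\overline{D}$ there exists $v\in D$ such that $N(v)\cap\overline{D}=\{u\}$; the super domination number $\gamma_{\rm sp}(G)$ is the minimum cardinality of a super dominating set of $G$. The Cartesian product $G\Box H$ has vertex set $V(G)\times V(H)$, with $(g,h)$ adjacent to $(g',h')$ iff either $g=g'$ and $hh'\in E(H)$, or $gg'\in E(G)$ and $h=h'$. -}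

module Defs where

open import Data.Nat using (ℕ; suc; _*_; _≤_)
open import Data.Fin using (Fin; combine; remQuot)
open import Data.Fin.Subset using (Subset; _∈_; _∉_; ∣_∣)
open import Data.Product using (Σ; _×_; _,_; ∃; ∃-syntax; proj₁; proj₂)
open import Data.Sum using (_⊎_)
open import Relation.Binary.PropositionalEquality using (_≡_)
open import Relation.Nullary using (¬_)

record Graph (n : ℕ) : Set₁ where
  field
    Adj     : Fin n → Fin n → Set
    sym     : ∀ {u v} → Adj u v → Adj v u
    irrefl  : ∀ {u} → ¬ Adj u u
open Graph public

Nonempty : ∀ {n} → Graph n → Set
Nonempty G = ∃[ u ] ∃[ v ] Adj G u v

K : (m : ℕ) → Graph m
K m = record { Adj = λ u v → ¬ u ≡ v ; sym = λ p q → p (symm q) ; irrefl = λ p → p reflx }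
  where
  open import Relation.Binary.PropositionalEquality using () renaming (sym to symm; refl to reflx)

-- Cartesian product G □ H, vertex (g , h) encoded as combine g h : Fin (n * n')
_□_ : ∀ {n n'} → Graph n → Graph n' → Graph (n * n')
_□_ {n} {n'} G H = record
  { Adj = λ x y → ProdAdj (remQuot n' x) (remQuot n' y)
  ; sym = λ { {x} {y} p → symP (remQuot n' x) (remQuot n' y) p }
  ; irrefl = λ { {x} p → irrP (remQuot n' x) p }
  }
  where
  ProdAdj : Fin n × Fin n' → Fin n × Fin n' → Set
  ProdAdj (g , h) (g' , h') = (g ≡ g' × Adj H h h') ⊎ (Adj G g g' × h ≡ h')
  open import Data.Sum using (inj₁; inj₂)
  open import Relation.Binary.PropositionalEquality using () renaming (sym to symm; refl to reflx)
  symP : ∀ a b → ProdAdj a b → ProdAdj b a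
  symP (g , h) (g' , h') (inj₁ (e , a)) = inj₁ (symm e , sym H a)
  symP (g , h) (g' , h') (inj₂ (a , e)) = inj₂ (sym G a , symm e)
  irrP : ∀ a → ¬ ProdAdj a a
  irrP (g , h) (inj₁ (_ , a)) = irrefl H a
  irrP (g , h) (inj₂ (a , _)) = irrefl G a

IsSuperDominating : ∀ {n} → Graph n → Subset n → Set
IsSuperDominating {n} G D =
  ∀ u → u ∉ D → ∃[ v ] (v ∈ D × Adj G v u × (∀ w → w ∉ D → Adj G v w → w ≡ u))

γsp≤ : ∀ {n} → Graph n → ℕ → Set
γsp≤ G k = ∃[ D ] (IsSuperDominating G D × ∣ D ∣ ≤ k)

γsp≡ : ∀ {n} → Graph n → ℕ → Set
γsp≡ {n} G k = (∃[ D ] (IsSuperDominating G D × ∣ D ∣ ≡ k))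
             × (∀ D → IsSuperDominating G D → k ≤ ∣ D ∣)

-- Write S for the complement of D; D is super dominating iff every u ∈ S has a neighbour
-- v ∉ S whose only neighbour in S is u. For edges g₁g₂ of G and h₁h₂ of H, the cross of all
-- (g, h₁) with g ∉ {g₁, g₂} and all (g₁, h) with h ∉ {h₁, h₂} is such an S, with private
-- neighbours (g, h₂) and (g₂, h), and it has n + n' − 4 vertices; a whole column {(g, h₁)}
-- works as well, which is optimal for K_n □ K_3.
-- Conversely, in K_n □ K_n' the private neighbour v of u ∈ S is adjacent to its whole row and
-- column. If v lies in the row of u, then u is the only vertex of S in that row and the column
-- of v misses S; symmetrically for columns. Hence the row-type vertices of S lie in distinct
-- rows and the column-type ones in distinct columns. If some column-type y exists, the
-- row-type vertices also avoid the row of y and the row that y's private neighbour keeps free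
-- of S, and symmetrically; so |S| ≤ max(n, n', n + n' − 4).

module Submission where

open import Defs hiding (sym)
open import Data.Nat using (ℕ; suc; _+_; _*_; _∸_; _≤_; z≤n; s≤s)
open import Data.Nat.Properties hiding (suc-injective; 0≢1+n; _≟_)
open import Data.Fin using (Fin; combine; remQuot; _≟_) renaming (zero to fzero; suc to fsuc)
open import Data.Fin.Properties using (suc-injective; 0≢1+n; remQuot-combine; combine-remQuot; all?; any?)
open import Data.Fin.Subset using (Subset; _∈_; _∉_; ∣_∣; ⊤; ∁; _∩_; _─_; _-_; ⁅_⁆; inside; outside; Empty)
open import Data.Fin.Subset.Properties
open import Data.Vec using (_∷_; []; tabulate; here; there)
open import Data.Vec.Properties using (lookup⇒[]=; []=⇒lookup; lookup∘tabulate)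
open import Data.Product using (_×_; _,_; ∃; ∃-syntax; proj₁; proj₂)
open import Data.Sum using (_⊎_; inj₁; inj₂)
open import Function using (_∘_)
open import Level using (Level)
open import Relation.Nullary using (¬_; does; proof; Reflects; invert; yes; no; contradiction)
open import Relation.Nullary.Decidable using (dec-true; _×-dec_; _⊎-dec_; _→-dec_; ¬?)
open import Relation.Unary using (Pred; Decidable)
open import Relation.Binary.PropositionalEquality

private
  variable
    ℓ : Level
    m k : ℕ
    A : Set

subset : {P : Pred (Fin m) ℓ} → Decidable P → Subset m
subset P? = tabulate (does ∘ P?)

module _ {P : Pred (Fin m) ℓ} (P? : Decidable P) where

  ∈-subset⁺ : ∀ {x} → P x → x ∈ subset P?
  ∈-subset⁺ {x} px = lookup⇒[]= x _ (trans (lookup∘tabulate _ x) (dec-true (P? x) px))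

  ∈-subset⁻ : ∀ {x} → x ∈ subset P? → P x
  ∈-subset⁻ {x} x∈ = invert (subst (Reflects (P x)) does≡true (proof (P? x)))
    where does≡true = trans (sym (lookup∘tabulate _ x)) ([]=⇒lookup x∈)

∣p∣+∣∁p∣≡n : ∀ (p : Subset m) → ∣ p ∣ + ∣ ∁ p ∣ ≡ m
∣p∣+∣∁p∣≡n p = trans (cong (∣ p ∣ +_) (∣∁p∣≡n∸∣p∣ p)) (m+[n∸m]≡n (∣p∣≤n p))

∣p∣≡∣p∩q∣+∣p∩∁q∣ : ∀ (p q : Subset m) → ∣ p ∣ ≡ ∣ p ∩ q ∣ + ∣ p ∩ ∁ q ∣
∣p∣≡∣p∩q∣+∣p∩∁q∣ []            []            = refl
∣p∣≡∣p∩q∣+∣p∩∁q∣ (outside ∷ p) (_ ∷ q)       = ∣p∣≡∣p∩q∣+∣p∩∁q∣ p q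
∣p∣≡∣p∩q∣+∣p∩∁q∣ (inside  ∷ p) (inside  ∷ q) = cong suc (∣p∣≡∣p∩q∣+∣p∩∁q∣ p q)
∣p∣≡∣p∩q∣+∣p∩∁q∣ (inside  ∷ p) (outside ∷ q) =
  trans (cong suc (∣p∣≡∣p∩q∣+∣p∩∁q∣ p q)) (sym (+-suc _ _))

x∈p⇒suc∣p-x∣≡∣p∣ : ∀ {p : Subset m} {x} → x ∈ p → suc ∣ p - x ∣ ≡ ∣ p ∣
x∈p⇒suc∣p-x∣≡∣p∣ {p = inside ∷ p} here = cong (suc ∘ ∣_∣) (p─⊥≡p p)
x∈p⇒suc∣p-x∣≡∣p∣ {p = inside  ∷ p} (there x∈p) = cong suc (x∈p⇒suc∣p-x∣≡∣p∣ x∈p)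
x∈p⇒suc∣p-x∣≡∣p∣ {p = outside ∷ p} (there x∈p) = x∈p⇒suc∣p-x∣≡∣p∣ x∈p

x∈p─q⇒x∉q : ∀ {p q : Subset m} {x} → x ∈ p ─ q → x ∉ q
x∈p─q⇒x∉q {p = _ ∷ _} {inside  ∷ _} (there x∈p─q) (there x∈q) = x∈p─q⇒x∉q x∈p─q x∈q
x∈p─q⇒x∉q {p = _ ∷ _} {outside ∷ _} (there x∈p─q) (there x∈q) = x∈p─q⇒x∉q x∈p─q x∈q

x∈⊤-y-z⇒x≢y×x≢z : ∀ {x y z : Fin m} → x ∈ ⊤ - y - z → x ≢ y × x ≢ z
x∈⊤-y-z⇒x≢y×x≢z {y = y} {z} x∈ =
  x∉⁅y⁆⇒x≢y (x∈p─q⇒x∉q (p─q⊆p (⊤ - y) ⁅ z ⁆ x∈)) , x∉⁅y⁆⇒x≢y (x∈p─q⇒x∉q x∈)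

x≢y⇒2+∣⊤-x-y∣≡n : ∀ {x y : Fin m} → x ≢ y → 2 + ∣ ⊤ - x - y ∣ ≡ m
x≢y⇒2+∣⊤-x-y∣≡n {m} {x} {y} x≢y = begin
  suc (suc ∣ ⊤ - x - y ∣) ≡⟨ cong suc (x∈p⇒suc∣p-x∣≡∣p∣ (x∈p∧x≢y⇒x∈p-y ∈⊤ (x≢y ∘ sym))) ⟩
  suc ∣ ⊤ - x ∣           ≡⟨ x∈p⇒suc∣p-x∣≡∣p∣ (∈⊤ {x = x}) ⟩
  ∣ ⊤ {m} ∣               ≡⟨ ∣⊤∣≡n m ⟩
  m                       ∎
  where open ≡-Reasoning

∈∧∉⇒≢ : ∀ {p : Subset m} {x y} → x ∈ p → y ∉ p → x ≢ y
∈∧∉⇒≢ x∈p y∉p refl = y∉p x∈p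

Empty⇒∣p∣≡0 : ∀ {p : Subset m} → Empty p → ∣ p ∣ ≡ 0
Empty⇒∣p∣≡0 {m} p-empty = trans (cong ∣_∣ (Empty-unique p-empty)) (∣⊥∣≡0 m)

InjectiveOn : Subset m → (Fin m → A) → Set
InjectiveOn p f = ∀ {x y} → x ∈ p → y ∈ p → f x ≡ f y → x ≡ y

injectiveOn-∷ : ∀ {s} {p : Subset m} {f : Fin (suc m) → A} →
  InjectiveOn (s ∷ p) f → InjectiveOn p (f ∘ fsuc)
injectiveOn-∷ inj x∈p y∈p e = suc-injective (inj (there x∈p) (there y∈p) e)

injectiveOn⇒∣p∣≤∣q∣ : ∀ {p : Subset m} {q : Subset k} (f : Fin m → Fin k) →
  (∀ {x} → x ∈ p → f x ∈ q) → InjectiveOn p f → ∣ p ∣ ≤ ∣ q ∣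
injectiveOn⇒∣p∣≤∣q∣ {p = []} f into inj = z≤n
injectiveOn⇒∣p∣≤∣q∣ {p = outside ∷ p} f into inj =
  injectiveOn⇒∣p∣≤∣q∣ (f ∘ fsuc) (into ∘ there) (injectiveOn-∷ inj)
injectiveOn⇒∣p∣≤∣q∣ {p = inside ∷ p} {q} f into inj = begin
  suc ∣ p ∣           ≤⟨ s≤s (injectiveOn⇒∣p∣≤∣q∣ (f ∘ fsuc) into′ (injectiveOn-∷ inj)) ⟩
  suc ∣ q - f fzero ∣ ≡⟨ x∈p⇒suc∣p-x∣≡∣p∣ (into here) ⟩
  ∣ q ∣               ∎
  where
  open ≤-Reasoning
  into′ : ∀ {x} → x ∈ p → f (fsuc x) ∈ q - f fzero
  into′ x∈p = x∈p∧x≢y⇒x∈p-y (into (there x∈p)) (λ e → 0≢1+n (inj here (there x∈p) (sym e)))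

injectiveOn⇒∣p∣≤n : ∀ {p : Subset m} (f : Fin m → Fin k) → InjectiveOn p f → ∣ p ∣ ≤ k
injectiveOn⇒∣p∣≤n {k = k} f inj =
  ≤-trans (injectiveOn⇒∣p∣≤∣q∣ f (λ _ → ∈⊤) inj) (≤-reflexive (∣⊤∣≡n k))

injectiveOn-avoiding⇒2+∣p∣≤n : ∀ {p : Subset m} {a b : Fin k} (f : Fin m → Fin k) → a ≢ b →
  (∀ {x} → x ∈ p → f x ≢ a × f x ≢ b) → InjectiveOn p f → 2 + ∣ p ∣ ≤ k
injectiveOn-avoiding⇒2+∣p∣≤n {p = p} {a} {b} f a≢b avoids inj = begin
  2 + ∣ p ∣         ≤⟨ s≤s (s≤s (injectiveOn⇒∣p∣≤∣q∣ f into inj)) ⟩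
  2 + ∣ ⊤ - a - b ∣ ≡⟨ x≢y⇒2+∣⊤-x-y∣≡n a≢b ⟩
  _                 ∎
  where
  open ≤-Reasoning
  into : ∀ {x} → x ∈ p → f x ∈ ⊤ - a - b
  into x∈p with avoids x∈p
  ... | fx≢a , fx≢b = x∈p∧x≢y⇒x∈p-y (x∈p∧x≢y⇒x∈p-y ∈⊤ fx≢a) fx≢b

∣p∣≡n∸∣∁p∣ : ∀ (p : Subset m) → ∣ p ∣ ≡ m ∸ ∣ ∁ p ∣
∣p∣≡n∸∣∁p∣ p = trans (sym (m+n∸n≡m ∣ p ∣ ∣ ∁ p ∣)) (cong (_∸ ∣ ∁ p ∣) (∣p∣+∣∁p∣≡n p))

m≤o+n⇒p∸n≤p+o∸m : ∀ {m n} o p → m ≤ o + n → p ∸ n ≤ p + o ∸ m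
m≤o+n⇒p∸n≤p+o∸m {m} {n} o p m≤o+n = begin
  p ∸ n           ≡⟨ [m+n]∸[m+o]≡n∸o o p n ⟨
  o + p ∸ (o + n) ≤⟨ ∸-monoʳ-≤ (o + p) m≤o+n ⟩
  o + p ∸ m       ≡⟨ cong (_∸ m) (+-comm o p) ⟩
  p + o ∸ m       ∎
  where open ≤-Reasoning

o+n≤m⇒p+o∸m≤p∸n : ∀ {m n} o p → o + n ≤ m → p + o ∸ m ≤ p ∸ n
o+n≤m⇒p+o∸m≤p∸n {m} {n} o p o+n≤m = begin
  p + o ∸ m       ≡⟨ cong (_∸ m) (+-comm p o) ⟩
  o + p ∸ m       ≤⟨ ∸-monoʳ-≤ (o + p) o+n≤m ⟩
  o + p ∸ (o + n) ≡⟨ [m+n]∸[m+o]≡n∸o o p n ⟩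
  p ∸ n           ∎
  where open ≤-Reasoning

adj⇒≢ : ∀ (G : Graph m) {u v} → Adj G u v → u ≢ v
adj⇒≢ G u~v refl = irrefl G u~v

HasPrivateNeighbours : Graph m → Pred (Fin m) ℓ → Set ℓ
HasPrivateNeighbours G P =
  ∀ u → P u → ∃[ v ] (¬ P v × Adj G v u × (∀ w → P w → Adj G v w → w ≡ u))

∁-isSuperDominating : ∀ (G : Graph m) {P : Pred (Fin m) ℓ} (P? : Decidable P) →
  HasPrivateNeighbours G P → IsSuperDominating G (∁ (subset P?))
∁-isSuperDominating G P? privateNeighbours u u∉∁S
  with privateNeighbours u (∈-subset⁻ P? (x∉∁p⇒x∈p u∉∁S))
... | v , ¬Pv , v~u , unique =
  v , x∉p⇒x∈∁p (¬Pv ∘ ∈-subset⁻ P?) , v~u , λ w → unique w ∘ ∈-subset⁻ P? ∘ x∉∁p⇒x∈p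

γsp≡-intro : ∀ (G : Graph m) {k} →
  γsp≤ G k → (∀ D → IsSuperDominating G D → k ≤ ∣ D ∣) → γsp≡ G k
γsp≡-intro G (D , sd , ∣D∣≤k) minimal = (D , sd , ≤-antisym ∣D∣≤k (minimal D sd)) , minimal

module Coordinates (n n' : ℕ) where

  row : Fin (n * n') → Fin n
  row x = proj₁ (remQuot {n} n' x)

  col : Fin (n * n') → Fin n'
  col x = proj₂ (remQuot {n} n' x)

  row-combine : ∀ g h → row (combine g h) ≡ g
  row-combine g h = cong proj₁ (remQuot-combine {n} {n'} g h)

  col-combine : ∀ g h → col (combine g h) ≡ h
  col-combine g h = cong proj₂ (remQuot-combine {n} {n'} g h)

  row-col-injective : ∀ {x y} → row x ≡ row y → col x ≡ col y → x ≡ y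
  row-col-injective {x} {y} r≡ c≡ = begin
    x                       ≡⟨ combine-remQuot {n} n' x ⟨
    combine (row x) (col x) ≡⟨ cong₂ combine r≡ c≡ ⟩
    combine (row y) (col y) ≡⟨ combine-remQuot {n} n' y ⟩
    y                       ∎
    where open ≡-Reasoning

  combine-injectiveOnˡ : ∀ {p : Subset n} (h : Fin n') → InjectiveOn p (λ g → combine g h)
  combine-injectiveOnˡ h {g} {g'} _ _ e =
    trans (sym (row-combine g h)) (trans (cong row e) (row-combine g' h))

  combine-injectiveOnʳ : ∀ {p : Subset n'} (g : Fin n) → InjectiveOn p (combine g)
  combine-injectiveOnʳ g {h} {h'} _ _ e =
    trans (sym (col-combine g h)) (trans (cong col e) (col-combine g h'))

  module Adjacency (G : Graph n) (H : Graph n') where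

    private
      AdjTo : Fin n × Fin n' → Fin (n * n') → Set
      AdjTo (g , h) w = (g ≡ row w × Adj H h (col w)) ⊎ (Adj G g (row w) × h ≡ col w)

    adj-combine⁻ : ∀ {g h w} → Adj (G □ H) (combine g h) w →
      (g ≡ row w × Adj H h (col w)) ⊎ (Adj G g (row w) × h ≡ col w)
    adj-combine⁻ {g} {h} {w} = subst (λ p → AdjTo p w) (remQuot-combine {n} {n'} g h)

    adj-combine⁺ : ∀ {g h w} → (g ≡ row w × Adj H h (col w)) ⊎ (Adj G g (row w) × h ≡ col w) →
      Adj (G □ H) (combine g h) w
    adj-combine⁺ {g} {h} {w} = subst (λ p → AdjTo p w) (sym (remQuot-combine {n} {n'} g h))

    column-neighbour : ∀ {g h₁ h₂ w} → h₁ ≢ h₂ →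
      Adj (G □ H) (combine g h₂) w → col w ≡ h₁ → row w ≡ g
    column-neighbour h₁≢h₂ v~w cw≡h₁ with adj-combine⁻ v~w
    ... | inj₁ (g≡rw , _) = sym g≡rw
    ... | inj₂ (_ , h₂≡cw) = contradiction (trans (sym cw≡h₁) (sym h₂≡cw)) h₁≢h₂

    row-neighbour : ∀ {g₁ g₂ h w} → g₁ ≢ g₂ →
      Adj (G □ H) (combine g₂ h) w → row w ≡ g₁ → col w ≡ h
    row-neighbour g₁≢g₂ v~w rw≡g₁ with adj-combine⁻ v~w
    ... | inj₁ (g₂≡rw , _) = contradiction (trans (sym rw≡g₁) (sym g₂≡rw)) g₁≢g₂
    ... | inj₂ (_ , h≡cw) = sym h≡cw

[2+m]+[2+n]≡4+[m+n] : ∀ m n → (2 + m) + (2 + n) ≡ 4 + (m + n)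
[2+m]+[2+n]≡4+[m+n] m n = cong (2 +_) (trans (+-suc m (suc n)) (cong suc (+-suc m n)))

module _ {n n' : ℕ} (G : Graph n) (H : Graph n') where
  open Coordinates n n'
  open Adjacency G H

  InColumn : Fin n' → Fin (n * n') → Set
  InColumn h x = col x ≡ h

  inColumn? : ∀ h → Decidable (InColumn h)
  inColumn? h x = col x ≟ h

  γsp≤-□-column : Nonempty H → γsp≤ (G □ H) (n * n' ∸ n)
  γsp≤-□-column (h₁ , h₂ , h₁~h₂) =
    ∁ S , ∁-isSuperDominating (G □ H) (inColumn? h₁) privateNeighbours , size
    where
    S = subset (inColumn? h₁)
    h₁≢h₂ = adj⇒≢ H h₁~h₂

    privateNeighbours : HasPrivateNeighbours (G □ H) (InColumn h₁)
    privateNeighbours u cu≡h₁ = combine (row u) h₂ , v∉ , v~u , unique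
      where
      v∉ : ¬ InColumn h₁ (combine (row u) h₂)
      v∉ cv≡h₁ = h₁≢h₂ (trans (sym cv≡h₁) (col-combine (row u) h₂))
      v~u : Adj (G □ H) (combine (row u) h₂) u
      v~u = adj-combine⁺ (inj₁ (refl , subst (Adj H h₂) (sym cu≡h₁) (Graph.sym H h₁~h₂)))
      unique : ∀ w → InColumn h₁ w → Adj (G □ H) (combine (row u) h₂) w → w ≡ u
      unique w cw≡h₁ v~w =
        row-col-injective (column-neighbour h₁≢h₂ v~w cw≡h₁) (trans cw≡h₁ (sym cu≡h₁))

    n≤∣S∣ : n ≤ ∣ S ∣
    n≤∣S∣ = ≤-trans (≤-reflexive (sym (∣⊤∣≡n n)))
      (injectiveOn⇒∣p∣≤∣q∣ {p = ⊤} (λ g → combine g h₁)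
        (λ {g} _ → ∈-subset⁺ (inColumn? h₁) (col-combine g h₁)) (combine-injectiveOnˡ h₁))

    size : ∣ ∁ S ∣ ≤ n * n' ∸ n
    size = begin
      ∣ ∁ S ∣       ≡⟨ ∣∁p∣≡n∸∣p∣ S ⟩
      n * n' ∸ ∣ S ∣ ≤⟨ ∸-monoʳ-≤ (n * n') n≤∣S∣ ⟩
      n * n' ∸ n    ∎
      where open ≤-Reasoning

  module CrossConstruction {g₁ g₂ h₁ h₂} (g₁~g₂ : Adj G g₁ g₂) (h₁~h₂ : Adj H h₁ h₂) where

    g₁≢g₂ = adj⇒≢ G g₁~g₂
    h₁≢h₂ = adj⇒≢ H h₁~h₂

    Cross′ : Fin n → Fin n' → Set
    Cross′ g h = (h ≡ h₁ × g ≢ g₁ × g ≢ g₂) ⊎ (g ≡ g₁ × h ≢ h₁ × h ≢ h₂)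

    Cross : Fin (n * n') → Set
    Cross x = Cross′ (row x) (col x)

    cross? : Decidable Cross
    cross? x = (col x ≟ h₁ ×-dec ¬? (row x ≟ g₁) ×-dec ¬? (row x ≟ g₂))
          ⊎-dec (row x ≟ g₁ ×-dec ¬? (col x ≟ h₁) ×-dec ¬? (col x ≟ h₂))

    cross-combine : ∀ {g h} → Cross′ g h → Cross (combine g h)
    cross-combine {g} {h} = subst₂ Cross′ (sym (row-combine g h)) (sym (col-combine g h))

    cross-privateNeighbours : HasPrivateNeighbours (G □ H) Cross
    cross-privateNeighbours u (inj₁ (cu≡h₁ , ru≢g₁ , _)) = combine (row u) h₂ , v∉ , v~u , unique
      where
      v∉ : ¬ Cross (combine (row u) h₂)
      v∉ (inj₁ (cv≡h₁ , _)) = h₁≢h₂ (trans (sym cv≡h₁) (col-combine (row u) h₂))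
      v∉ (inj₂ (rv≡g₁ , _)) = ru≢g₁ (trans (sym (row-combine (row u) h₂)) rv≡g₁)
      v~u : Adj (G □ H) (combine (row u) h₂) u
      v~u = adj-combine⁺ (inj₁ (refl , subst (Adj H h₂) (sym cu≡h₁) (Graph.sym H h₁~h₂)))
      unique : ∀ w → Cross w → Adj (G □ H) (combine (row u) h₂) w → w ≡ u
      unique w (inj₁ (cw≡h₁ , _)) v~w =
        row-col-injective (column-neighbour h₁≢h₂ v~w cw≡h₁) (trans cw≡h₁ (sym cu≡h₁))
      unique w (inj₂ (rw≡g₁ , _ , cw≢h₂)) v~w with adj-combine⁻ v~w
      ... | inj₁ (ru≡rw , _) = contradiction (trans ru≡rw rw≡g₁) ru≢g₁
      ... | inj₂ (_ , h₂≡cw) = contradiction (sym h₂≡cw) cw≢h₂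
    cross-privateNeighbours u (inj₂ (ru≡g₁ , cu≢h₁ , _)) = combine g₂ (col u) , v∉ , v~u , unique
      where
      v∉ : ¬ Cross (combine g₂ (col u))
      v∉ (inj₁ (cv≡h₁ , _)) = cu≢h₁ (trans (sym (col-combine g₂ (col u))) cv≡h₁)
      v∉ (inj₂ (rv≡g₁ , _)) = g₁≢g₂ (trans (sym rv≡g₁) (row-combine g₂ (col u)))
      v~u : Adj (G □ H) (combine g₂ (col u)) u
      v~u = adj-combine⁺ (inj₂ (subst (Adj G g₂) (sym ru≡g₁) (Graph.sym G g₁~g₂) , refl))
      unique : ∀ w → Cross w → Adj (G □ H) (combine g₂ (col u)) w → w ≡ u
      unique w (inj₂ (rw≡g₁ , _)) v~w =
        row-col-injective (trans rw≡g₁ (sym ru≡g₁)) (row-neighbour g₁≢g₂ v~w rw≡g₁)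
      unique w (inj₁ (cw≡h₁ , _ , rw≢g₂)) v~w with adj-combine⁻ v~w
      ... | inj₁ (g₂≡rw , _) = contradiction (sym g₂≡rw) rw≢g₂
      ... | inj₂ (_ , cu≡cw) = contradiction (trans cu≡cw cw≡h₁) cu≢h₁

    S = subset cross?
    T = subset (inColumn? h₁)

    ∣⊤-g₁-g₂∣≤∣S∩T∣ : ∣ ⊤ - g₁ - g₂ ∣ ≤ ∣ S ∩ T ∣
    ∣⊤-g₁-g₂∣≤∣S∩T∣ = injectiveOn⇒∣p∣≤∣q∣ (λ g → combine g h₁) into (combine-injectiveOnˡ h₁)
      where
      into : ∀ {g} → g ∈ ⊤ - g₁ - g₂ → combine g h₁ ∈ S ∩ T
      into {g} g∈ with x∈⊤-y-z⇒x≢y×x≢z g∈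
      ... | g≢g₁ , g≢g₂ = x∈p∩q⁺ (∈-subset⁺ cross? (cross-combine (inj₁ (refl , g≢g₁ , g≢g₂)))
                                 , ∈-subset⁺ (inColumn? h₁) (col-combine g h₁))

    ∣⊤-h₁-h₂∣≤∣S∩∁T∣ : ∣ ⊤ - h₁ - h₂ ∣ ≤ ∣ S ∩ ∁ T ∣
    ∣⊤-h₁-h₂∣≤∣S∩∁T∣ = injectiveOn⇒∣p∣≤∣q∣ (combine g₁) into (combine-injectiveOnʳ g₁)
      where
      into : ∀ {h} → h ∈ ⊤ - h₁ - h₂ → combine g₁ h ∈ S ∩ ∁ T
      into {h} h∈ with x∈⊤-y-z⇒x≢y×x≢z h∈
      ... | h≢h₁ , h≢h₂ = x∈p∩q⁺ (∈-subset⁺ cross? (cross-combine (inj₂ (refl , h≢h₁ , h≢h₂)))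
        , x∉p⇒x∈∁p λ c∈T → h≢h₁ (trans (sym (col-combine g₁ h)) (∈-subset⁻ (inColumn? h₁) c∈T)))

    n+n'≤4+∣S∣ : n + n' ≤ 4 + ∣ S ∣
    n+n'≤4+∣S∣ = begin
      n + n'                                      ≡⟨ cong₂ _+_ (x≢y⇒2+∣⊤-x-y∣≡n g₁≢g₂)
                                                               (x≢y⇒2+∣⊤-x-y∣≡n h₁≢h₂) ⟨
      (2 + ∣ ⊤ - g₁ - g₂ ∣) + (2 + ∣ ⊤ - h₁ - h₂ ∣) ≤⟨ +-mono-≤ (s≤s (s≤s ∣⊤-g₁-g₂∣≤∣S∩T∣))
                                                               (s≤s (s≤s ∣⊤-h₁-h₂∣≤∣S∩∁T∣)) ⟩
      (2 + ∣ S ∩ T ∣) + (2 + ∣ S ∩ ∁ T ∣)          ≡⟨ [2+m]+[2+n]≡4+[m+n] ∣ S ∩ T ∣ ∣ S ∩ ∁ T ∣ ⟩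
      4 + (∣ S ∩ T ∣ + ∣ S ∩ ∁ T ∣)               ≡⟨ cong (4 +_) (∣p∣≡∣p∩q∣+∣p∩∁q∣ S T) ⟨
      4 + ∣ S ∣                                   ∎
      where open ≤-Reasoning

  γsp≤-□ : Nonempty G → Nonempty H → γsp≤ (G □ H) (n * n' + 4 ∸ n ∸ n')
  γsp≤-□ (_ , _ , g₁~g₂) (_ , _ , h₁~h₂) =
    ∁ S , ∁-isSuperDominating (G □ H) cross? cross-privateNeighbours , size
    where
    open CrossConstruction g₁~g₂ h₁~h₂
    size : ∣ ∁ S ∣ ≤ n * n' + 4 ∸ n ∸ n'
    size = begin
      ∣ ∁ S ∣               ≡⟨ ∣∁p∣≡n∸∣p∣ S ⟩
      n * n' ∸ ∣ S ∣         ≤⟨ m≤o+n⇒p∸n≤p+o∸m 4 (n * n') n+n'≤4+∣S∣ ⟩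
      n * n' + 4 ∸ (n + n') ≡⟨ ∸-+-assoc (n * n' + 4) n n' ⟨
      n * n' + 4 ∸ n ∸ n'   ∎
      where open ≤-Reasoning

module _ (n n' : ℕ) where
  open Coordinates n n'

  sameRow⇒adj : ∀ {x y} → row x ≡ row y → x ≢ y → Adj (K n □ K n') x y
  sameRow⇒adj r≡ x≢y = inj₁ (r≡ , λ c≡ → x≢y (row-col-injective r≡ c≡))

  sameCol⇒adj : ∀ {x y} → col x ≡ col y → x ≢ y → Adj (K n □ K n') x y
  sameCol⇒adj c≡ x≢y = inj₂ ((λ r≡ → x≢y (row-col-injective r≡ c≡)) , c≡)

  module _ (S : Subset (n * n')) where

    AloneInRow AloneInCol : Fin (n * n') → Set
    AloneInRow x = ∀ y → y ∈ S → row y ≡ row x → y ≡ x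
    AloneInCol x = ∀ y → y ∈ S → col y ≡ col x → y ≡ x

    RowFree : Fin n → Set
    RowFree i = ∀ y → y ∈ S → row y ≢ i

    ColFree : Fin n' → Set
    ColFree j = ∀ y → y ∈ S → col y ≢ j

    -- The shape forced on x ∈ S when its private neighbour lies in the row (resp. column) of x.
    RowPrivate ColPrivate : Fin (n * n') → Set
    RowPrivate x = AloneInRow x × ∃ ColFree
    ColPrivate x = AloneInCol x × ∃ RowFree

    rowPrivate? : Decidable RowPrivate
    rowPrivate? x = all? (λ y → y ∈? S →-dec (row y ≟ row x →-dec y ≟ x))
             ×-dec any? (λ j → all? (λ y → y ∈? S →-dec ¬? (col y ≟ j)))

  superDominating⇒private : ∀ {D} → IsSuperDominating (K n □ K n') D →
    ∀ x → x ∈ ∁ D → RowPrivate (∁ D) x ⊎ ColPrivate (∁ D) x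
  superDominating⇒private {D} sd x x∈∁D with sd x (x∈∁p⇒x∉p x∈∁D)
  ... | v , v∈D , inj₁ (rv≡rx , cv≢cx) , unique = inj₁ (alone , col v , free)
    where
    alone : AloneInRow (∁ D) x
    alone y y∈∁D ry≡rx =
      unique y (x∈∁p⇒x∉p y∈∁D) (sameRow⇒adj (trans rv≡rx (sym ry≡rx)) (∈∧∉⇒≢ v∈D (x∈∁p⇒x∉p y∈∁D)))
    free : ColFree (∁ D) (col v)
    free y y∈∁D cy≡cv = cv≢cx (trans (sym cy≡cv) (cong col y≡x))
      where
      y≡x = unique y (x∈∁p⇒x∉p y∈∁D) (sameCol⇒adj (sym cy≡cv) (∈∧∉⇒≢ v∈D (x∈∁p⇒x∉p y∈∁D)))
  ... | v , v∈D , inj₂ (rv≢rx , cv≡cx) , unique = inj₂ (alone , row v , free)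
    where
    alone : AloneInCol (∁ D) x
    alone y y∈∁D cy≡cx =
      unique y (x∈∁p⇒x∉p y∈∁D) (sameCol⇒adj (trans cv≡cx (sym cy≡cx)) (∈∧∉⇒≢ v∈D (x∈∁p⇒x∉p y∈∁D)))
    free : RowFree (∁ D) (row v)
    free y y∈∁D ry≡rv = rv≢rx (trans (sym ry≡rv) (cong row y≡x))
      where
      y≡x = unique y (x∈∁p⇒x∉p y∈∁D) (sameRow⇒adj (sym ry≡rv) (∈∧∉⇒≢ v∈D (x∈∁p⇒x∉p y∈∁D)))

  module PrivateCount (S : Subset (n * n'))
    (classify : ∀ x → x ∈ S → RowPrivate S x ⊎ ColPrivate S x) where

    R = subset (rowPrivate? S)
    X = S ∩ R
    Y = S ∩ ∁ R

    ∈X⁻ : ∀ {x} → x ∈ X → x ∈ S × RowPrivate S x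
    ∈X⁻ x∈X with x∈p∩q⁻ S R x∈X
    ... | x∈S , x∈R = x∈S , ∈-subset⁻ (rowPrivate? S) x∈R

    ∈Y⁻ : ∀ {y} → y ∈ Y → y ∈ S × ColPrivate S y × ¬ RowPrivate S y
    ∈Y⁻ {y} y∈Y with x∈p∩q⁻ S (∁ R) y∈Y
    ... | y∈S , y∈∁R with classify y y∈S
    ...   | inj₁ rp = contradiction (∈-subset⁺ (rowPrivate? S) rp) (x∈∁p⇒x∉p y∈∁R)
    ...   | inj₂ cp = y∈S , cp , λ rp → x∈∁p⇒x∉p y∈∁R (∈-subset⁺ (rowPrivate? S) rp)

    row-injective : InjectiveOn X row
    row-injective x∈X x'∈X r≡ = proj₁ (proj₂ (∈X⁻ x'∈X)) _ (proj₁ (∈X⁻ x∈X)) r≡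

    col-injective : InjectiveOn Y col
    col-injective y∈Y y'∈Y c≡ = proj₁ (proj₁ (proj₂ (∈Y⁻ y'∈Y))) _ (proj₁ (∈Y⁻ y∈Y)) c≡

    2+∣X∣≤n : ∀ {y₀} → y₀ ∈ Y → 2 + ∣ X ∣ ≤ n
    2+∣X∣≤n {y₀} y₀∈Y with ∈Y⁻ y₀∈Y
    ... | y₀∈S , (_ , i₀ , i₀-free) , ¬rp₀ =
      injectiveOn-avoiding⇒2+∣p∣≤n row (i₀-free y₀ y₀∈S ∘ sym) avoids row-injective
      where
      avoids : ∀ {x} → x ∈ X → row x ≢ i₀ × row x ≢ row y₀
      avoids {x} x∈X with ∈X⁻ x∈X
      ... | x∈S , rp@(alone , _) =
        i₀-free x x∈S , λ rx≡ry₀ → ¬rp₀ (subst (RowPrivate S) (sym (alone y₀ y₀∈S (sym rx≡ry₀))) rp)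

    2+∣Y∣≤n' : ∀ {x₀} → x₀ ∈ X → 2 + ∣ Y ∣ ≤ n'
    2+∣Y∣≤n' {x₀} x₀∈X with ∈X⁻ x₀∈X
    ... | x₀∈S , rp₀@(_ , j₀ , j₀-free) =
      injectiveOn-avoiding⇒2+∣p∣≤n col (j₀-free x₀ x₀∈S ∘ sym) avoids col-injective
      where
      avoids : ∀ {y} → y ∈ Y → col y ≢ j₀ × col y ≢ col x₀
      avoids {y} y∈Y with ∈Y⁻ y∈Y
      ... | y∈S , (alone , _) , ¬rp =
        j₀-free y y∈S , λ cy≡cx₀ → ¬rp (subst (RowPrivate S) (alone x₀ x₀∈S (sym cy≡cx₀)) rp₀)

    ∣S∣-bound : ∣ S ∣ ≤ n ⊎ ∣ S ∣ ≤ n' ⊎ 4 + ∣ S ∣ ≤ n + n'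
    ∣S∣-bound with nonempty? X | nonempty? Y
    ... | no X-empty | _ = inj₂ (inj₁ (begin
      ∣ S ∣         ≡⟨ ∣p∣≡∣p∩q∣+∣p∩∁q∣ S R ⟩
      ∣ X ∣ + ∣ Y ∣ ≡⟨ cong (_+ ∣ Y ∣) (Empty⇒∣p∣≡0 X-empty) ⟩
      ∣ Y ∣         ≤⟨ injectiveOn⇒∣p∣≤n col col-injective ⟩
      n'            ∎))
      where open ≤-Reasoning
    ... | yes _ | no Y-empty = inj₁ (begin
      ∣ S ∣         ≡⟨ ∣p∣≡∣p∩q∣+∣p∩∁q∣ S R ⟩
      ∣ X ∣ + ∣ Y ∣ ≡⟨ cong (∣ X ∣ +_) (Empty⇒∣p∣≡0 Y-empty) ⟩
      ∣ X ∣ + 0     ≡⟨ +-identityʳ ∣ X ∣ ⟩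
      ∣ X ∣         ≤⟨ injectiveOn⇒∣p∣≤n row row-injective ⟩
      n             ∎)
      where open ≤-Reasoning
    ... | yes (_ , x₀∈X) | yes (_ , y₀∈Y) = inj₂ (inj₂ (begin
      4 + ∣ S ∣                 ≡⟨ cong (4 +_) (∣p∣≡∣p∩q∣+∣p∩∁q∣ S R) ⟩
      4 + (∣ X ∣ + ∣ Y ∣)       ≡⟨ [2+m]+[2+n]≡4+[m+n] ∣ X ∣ ∣ Y ∣ ⟨
      (2 + ∣ X ∣) + (2 + ∣ Y ∣) ≤⟨ +-mono-≤ (2+∣X∣≤n y₀∈Y) (2+∣Y∣≤n' x₀∈X) ⟩
      n + n'                    ∎))
      where open ≤-Reasoning

K-nonempty : 2 ≤ m → Nonempty (K m)
K-nonempty (s≤s (s≤s _)) = fzero , fsuc fzero , λ ()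

∣∁D∣-bound : ∀ n n' {D} → IsSuperDominating (K n □ K n') D →
  ∣ ∁ D ∣ ≤ n ⊎ ∣ ∁ D ∣ ≤ n' ⊎ 4 + ∣ ∁ D ∣ ≤ n + n'
∣∁D∣-bound n n' sd = PrivateCount.∣S∣-bound n n' (∁ _) (superDominating⇒private n n' sd)

γsp≡-K□K : ∀ n n' → 4 ≤ n → 4 ≤ n' → γsp≡ (K n □ K n') (n * n' + 4 ∸ n ∸ n')
γsp≡-K□K n n' 4≤n 4≤n' =
  γsp≡-intro (K n □ K n') (γsp≤-□ (K n) (K n') (K-nonempty 2≤n) (K-nonempty 2≤n')) lower
  where
  2≤n = ≤-trans (s≤s (s≤s z≤n)) 4≤n
  2≤n' = ≤-trans (s≤s (s≤s z≤n)) 4≤n'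
  4+∣∁D∣≤n+n' : ∀ {D} → IsSuperDominating (K n □ K n') D → 4 + ∣ ∁ D ∣ ≤ n + n'
  4+∣∁D∣≤n+n' sd with ∣∁D∣-bound n n' sd
  ... | inj₁ ∣∁D∣≤n = ≤-trans (+-mono-≤ 4≤n' ∣∁D∣≤n) (≤-reflexive (+-comm n' n))
  ... | inj₂ (inj₁ ∣∁D∣≤n') = +-mono-≤ 4≤n ∣∁D∣≤n'
  ... | inj₂ (inj₂ 4+∣∁D∣≤n+n') = 4+∣∁D∣≤n+n'
  lower : ∀ D → IsSuperDominating (K n □ K n') D → n * n' + 4 ∸ n ∸ n' ≤ ∣ D ∣
  lower D sd = begin
    n * n' + 4 ∸ n ∸ n'   ≡⟨ ∸-+-assoc (n * n' + 4) n n' ⟩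
    n * n' + 4 ∸ (n + n') ≤⟨ o+n≤m⇒p+o∸m≤p∸n 4 (n * n') (4+∣∁D∣≤n+n' sd) ⟩
    n * n' ∸ ∣ ∁ D ∣       ≡⟨ ∣p∣≡n∸∣∁p∣ D ⟨
    ∣ D ∣                 ∎
    where open ≤-Reasoning

γsp≡-K□K₃ : ∀ n → 3 ≤ n → γsp≡ (K n □ K 3) (2 * n)
γsp≡-K□K₃ n 3≤n = γsp≡-intro (K n □ K 3) (subst (γsp≤ (K n □ K 3)) n*3∸n≡2*n column) lower
  where
  n*3∸n≡2*n : n * 3 ∸ n ≡ 2 * n
  n*3∸n≡2*n = trans (cong (_∸ n) (*-comm n 3)) (m+n∸m≡n n (2 * n))
  column = γsp≤-□-column (K n) (K 3) (K-nonempty (s≤s (s≤s z≤n)))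
  ∣∁D∣≤n : ∀ {D} → IsSuperDominating (K n □ K 3) D → ∣ ∁ D ∣ ≤ n
  ∣∁D∣≤n sd with ∣∁D∣-bound n 3 sd
  ... | inj₁ ∣∁D∣≤n = ∣∁D∣≤n
  ... | inj₂ (inj₁ ∣∁D∣≤3) = ≤-trans ∣∁D∣≤3 3≤n
  ... | inj₂ (inj₂ 4+∣∁D∣≤n+3) = +-cancelˡ-≤ 4 _ n (≤-trans 4+∣∁D∣≤n+3 n+3≤4+n)
    where n+3≤4+n = ≤-trans (+-monoʳ-≤ n (n≤1+n 3)) (≤-reflexive (+-comm n 4))
  lower : ∀ D → IsSuperDominating (K n □ K 3) D → 2 * n ≤ ∣ D ∣
  lower D sd = begin
    2 * n           ≡⟨ n*3∸n≡2*n ⟨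
    n * 3 ∸ n       ≤⟨ ∸-monoʳ-≤ (n * 3) (∣∁D∣≤n sd) ⟩
    n * 3 ∸ ∣ ∁ D ∣ ≡⟨ ∣p∣≡n∸∣∁p∣ D ⟨
    ∣ D ∣           ∎
    where open ≤-Reasoning

theorem30 :
  ((n n' : ℕ) (G : Graph n) (H : Graph n') → 2 ≤ n → 2 ≤ n' → Nonempty G → Nonempty H →
    γsp≤ (G □ H) (n * n' + 4 ∸ n ∸ n'))
  × ((n n' : ℕ) → 4 ≤ n → 4 ≤ n' → γsp≡ (K n □ K n') (n * n' + 4 ∸ n ∸ n'))
  × ((n : ℕ) → 3 ≤ n → γsp≡ (K n □ K 3) (2 * n))
-- The order hypotheses of the first part are implied by nonemptiness.
theorem30 = (λ _ _ G H _ _ → γsp≤-□ G H) , γsp≡-K□K , γsp≡-K□K₃
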